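{- Let $\mathcal{T}_-$ be the rooted tree obtained from the set $SP_-$ of $(-)$-search paths (viewed as edge sequences of $G$ starting at the root) by merging common prefixes, and $\mathcal{T}_+$ the tree obtained from the set $SP_+$ of $(+)$-search paths (edge sequences ending at the sink) by merging common suffixes. Then $\mathcal{T}_-$ is a forward spanning tree for $ES_-\cup\{f^\bot_-\}$ rooted at the root of $G$, $\mathcal{T}_+$ is a backward spanning tree for $ES_+\cup\{f^\bot_+\}$ rooted at the sink of $G$ (their leaves correspond to the respective certificates), and each of $\mathcal{T}_-$ and $\mathcal{T}_+$ has at most $e$ edges.
   Context: Let $T=T[1..n]$ be a text over an integer alphabet with total order, ending with a unique smallest end-marker $\$$; $T_p=T[p..n]$. $\le_{\mathrm{lex}}$ is lexicographic order; $X\le_{\mathrm{pos}}Y$ iff $|X|\ge|Y|$. The CDAWG $G$ of $T$ is the edge-labeled DAG obtained from the suffix tree of $T$ by merging isomorphic subtrees; it has a root and a sink, edges $f=(v,X,w)$ with nonempty labels, outgoing edges of a node start with distinct symbols, and spelling root-to-sink paths is a bijection onto the set of suffixes of $T$. Its size $e$ is its number of edges plus suffix links; $E$ is its edge set. For a node $v$, $N_-(v)$/$N_+(v)$ are incoming/outgoing edges, $U_-(v)$ the strings spelled by root-to-$v$ paths, $U_+(v)$ the strings spelled by $v$-to-sink paths. Fix $\preceq_-=\le_{\mathrm{pos}}$ and $\preceq_+\in\{\le_{\mathrm{lex}},\le_{\mathrm{pos}}\}$; $\mathrm{repr}_\delta(v)=\min_{\preceq_\delta}U_\delta(v)$ for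 $\delta\in\{ -,+\}$ (strings identified with the unique paths spelling them). An edge of $N_-(v)$ is $(-)$-primary if it is the last edge of the path of $\mathrm{repr}_-(v)$; an edge of $N_+(v)$ is $(+)$-primary if it is the first edge of the path of $\mathrm{repr}_+(v)$; $EP_\delta$ = $\delta$-primary edges, $ES_\delta=E\setminus EP_\delta$. $f^\bot_-$, $f^\bot_+$ are two imaginary edges not in $E$. A suffix $S$ with root-to-sink path $\pi=(f_1,\dots,f_\ell)$ is $\delta$-trivial if all $f_i\in EP_\delta$. $S$ has a $(-)$-canonical factoring at $k$ if $f_1,\dots,f_{k-1}\in EP_-$, $f_k\in ES_-$, $f_{k+1},\dots,f_\ell\in EP_+$; a $(+)$-canonical factoring at $k$ if $f_1,\dots,f_{k-1}\in EP_-$, $f_k\in ES_+$, $f_{k+1},\dots,f_\ell\in EP_+$. Its $\delta$-certificate is $f_k$ (or $f^\bot_\delta$ if $S$ is $\delta$-trivial). Its $(-)$-search path is $(f_1,\dots,f_k)$ and its $(+)$-search path is $(f_k,\dots,f_\ell)$; for a $\delta$-trivial suffix the $\delta$-search path is the whole $\pi$. $SP_\delta$ is the set of all $\delta$-search paths of suffixes having a $\delta$-canonical factoring or being $\delta$-trivial. -}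

module Defs where

open import Data.Nat using (ℕ; _<_; _≤_)
open import Data.Fin using (Fin)
open import Data.List using (List; []; _∷_; _++_; [_]; length; drop; concatMap)
open import Data.List.Relation.Unary.All using (All)
open import Data.List.Relation.Unary.Any using (Any)
open import Data.List.Relation.Unary.Unique.Propositional using (Unique)
open import Data.List.Relation.Binary.Lex.Core using (Lex-≤)
open import Data.Product using (Σ; ∃; ∃-syntax; _×_; _,_)
open import Data.Sum using (_⊎_; inj₁; inj₂)
open import Data.Unit using (⊤; tt)
open import Relation.Nullary using (¬_)
open import Relation.Binary.PropositionalEquality using (_≡_; _≢_)

Str : Set
Str = List ℕ

EndMarked : Str → Set
EndMarked T = ∃[ T' ] ∃[ d ] (T ≡ T' ++ [ d ]) × All (λ x → d < x) T'

-- T_p for p = 1..n is  drop (p-1) T ; so the suffixes of T are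
-- drop q T with q < length T.
IsSuffixOf : Str → Str → Set
IsSuffixOf S T = ∃[ q ] (q < length T) × (S ≡ drop q T)

_≤pos_ : Str → Str → Set
X ≤pos Y = length Y ≤ length X

_≤lex_ : Str → Str → Set
X ≤lex Y = Lex-≤ _≡_ _<_ X Y

data PlusOrder : Set where
  lexOrder posOrder : PlusOrder

⟦_⟧₊ : PlusOrder → Str → Str → Set
⟦ lexOrder ⟧₊ = _≤lex_
⟦ posOrder ⟧₊ = _≤pos_

record Graph : Set where
  field
    nodes         : ℕ
    edges         : ℕ
    src tgt       : Fin edges → Fin nodes
    label         : Fin edges → Str
    root sink     : Fin nodes
    suffixLinks   : ℕ        -- number of suffix links of the CDAWG

module _ (G : Graph) where
  open Graph G

  size : ℕ
  size = edges Data.Nat.+ suffixLinks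

  EPath : Set
  EPath = List (Fin edges)

  data IsPath : Fin nodes → EPath → Fin nodes → Set where
    []  : ∀ {u} → IsPath u [] u
    _∷_ : ∀ {f π v} → IsPath (tgt f) π v → IsPath (src f) (f ∷ π) v

  spell : EPath → Str
  spell = concatMap label

  record IsCDAWGOf (T : Str) : Set where
    field
      labelNonEmpty : ∀ f → label f ≢ []
      distinctFirst : ∀ f g a X Y → src f ≡ src g →
                      label f ≡ a ∷ X → label g ≡ a ∷ Y → f ≡ g
      acyclic       : ∀ v f π → ¬ IsPath v (f ∷ π) v
      fromRoot      : ∀ v → ∃[ π ] IsPath root π v
      toSink        : ∀ v → ∃[ π ] IsPath v π sink
      spellSuffix   : ∀ π → IsPath root π sink → IsSuffixOf (spell π) T
      spellOnto     : ∀ S → IsSuffixOf S T → ∃[ π ] IsPath root π sink × spell π ≡ S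
      spellInj      : ∀ π π' → IsPath root π sink → IsPath root π' sink →
                      spell π ≡ spell π' → π ≡ π'

  IsRepr₋Path : Fin nodes → EPath → Set
  IsRepr₋Path v π = IsPath root π v ×
    (∀ π' → IsPath root π' v → spell π ≤pos spell π')

  IsRepr₊Path : PlusOrder → Fin nodes → EPath → Set
  IsRepr₊Path o v π = IsPath v π sink ×
    (∀ π' → IsPath v π' sink → ⟦ o ⟧₊ (spell π) (spell π'))

  EP₋ : Fin edges → Set
  EP₋ f = ∃[ π ] IsRepr₋Path (tgt f) (π ++ [ f ])

  ES₋ : Fin edges → Set
  ES₋ f = ¬ EP₋ f

  EP₊ : PlusOrder → Fin edges → Set
  EP₊ o f = ∃[ π ] IsRepr₊Path o (src f) (f ∷ π)

  ES₊ : PlusOrder → Fin edges → Set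
  ES₊ o f = ¬ EP₊ o f

  -- certificates (inj₁ f = edge f ; inj₂ tt = the imaginary edge f⊥)
  -- and search paths.

  Cert : Set
  Cert = Fin edges ⊎ ⊤

  data SearchPath₋ (T : Str) (o : PlusOrder) : EPath → Cert → Set where
    canonical : ∀ S π α f β → IsSuffixOf S T → IsPath root π sink → spell π ≡ S →
                π ≡ α ++ f ∷ β → All EP₋ α → ES₋ f → All (EP₊ o) β →
                SearchPath₋ T o (α ++ [ f ]) (inj₁ f)
    trivial   : ∀ S π → IsSuffixOf S T → IsPath root π sink → spell π ≡ S →
                All EP₋ π → SearchPath₋ T o π (inj₂ tt)

  data SearchPath₊ (T : Str) (o : PlusOrder) : EPath → Cert → Set where
    canonical : ∀ S π α f β → IsSuffixOf S T → IsPath root π sink → spell π ≡ S →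
                π ≡ α ++ f ∷ β → All EP₋ α → ES₊ o f → All (EP₊ o) β →
                SearchPath₊ T o (f ∷ β) (inj₁ f)
    trivial   : ∀ S π → IsSuffixOf S T → IsPath root π sink → spell π ≡ S →
                All (EP₊ o) π → SearchPath₊ T o π (inj₂ tt)

  -- Tries of edge sequences.
  -- 𝒯 obtained from a set SP of edge sequences by merging common
  -- prefixes: its nodes are the prefixes of members of SP, its edges
  -- are (in bijection with) the nonempty prefixes, its leaves are the
  -- members of SP that are not proper prefixes of other members.
  -- Merging common suffixes is the mirror image.

  IsPrefix : EPath → EPath → Set
  IsPrefix p σ = ∃[ r ] p ++ r ≡ σ

  IsSuffix : EPath → EPath → Set
  IsSuffix s σ = ∃[ r ] r ++ s ≡ σ

  PrefixTrieEdge : (EPath → Set) → EPath → Set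
  PrefixTrieEdge SP p = p ≢ [] × ∃[ σ ] SP σ × IsPrefix p σ

  SuffixTrieEdge : (EPath → Set) → EPath → Set
  SuffixTrieEdge SP s = s ≢ [] × ∃[ σ ] SP σ × IsSuffix s σ

  AtMostEdges : (EPath → Set) → ℕ → Set
  AtMostEdges Edge k = ∀ (L : List EPath) → Unique L → All Edge L → length L ≤ k

  -- The certificate relation C : EPath → Cert → Set restricted to the
  -- leaves is a bijection onto F ⊎ {f⊥}.
  LeavesCorrespond : (EPath → Cert → Set) → (Fin edges → Set) → Set
  LeavesCorrespond C F =
      (∀ σ c c' → C σ c → C σ c' → c ≡ c')
    × (∀ σ σ' c → C σ c → C σ' c → σ ≡ σ')
    × (∀ σ f → C σ (inj₁ f) → F f)
    × (∀ f → F f → ∃[ σ ] C σ (inj₁ f))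
    × (∃[ σ ] C σ (inj₂ tt))

  -- forward spanning tree for F ∪ {f⊥} rooted at the root, given as the
  -- prefix-trie of SP = {σ | ∃ c. C σ c}
  ForwardSpanningTree : (EPath → Cert → Set) → (Fin edges → Set) → Set
  ForwardSpanningTree C F =
      (∀ σ c → C σ c → ∃[ v ] IsPath root σ v)
      -- leaves: no member of SP is a proper prefix of another member
    × (∀ σ σ' c c' → C σ c → C σ' c' → IsPrefix σ σ' → σ ≡ σ')
      -- spanning: every node of G is reached by some trie node
    × (∀ v → ∃[ σ ] ∃[ c ] ∃[ p ] C σ c × IsPrefix p σ × IsPath root p v)
    × LeavesCorrespond C F

  -- backward spanning tree for F ∪ {f⊥} rooted at the sink, given as the
  -- suffix-trie of SP = {σ | ∃ c. C σ c}
  BackwardSpanningTree : (EPath → Cert → Set) → (Fin edges → Set) → Set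
  BackwardSpanningTree C F =
      (∀ σ c → C σ c → ∃[ v ] IsPath v σ sink)
    × (∀ σ σ' c c' → C σ c → C σ' c' → IsSuffix σ σ' → σ ≡ σ')
    × (∀ v → ∃[ σ ] ∃[ c ] ∃[ s ] C σ c × IsSuffix s σ × IsPath v s sink)
    × LeavesCorrespond C F

{-# OPTIONS --safe #-}

-- Root-to-sink paths of a CDAWG are finitely many and are determined by the
-- length of the suffix they spell.  Hence every node v has a unique
-- (−)-representative path ρ(v) from the root and a unique (+)-representative
-- path τ(v) to the sink; prefixes of ρ(v) and suffixes of τ(v) are again
-- representatives, so a path from the root is ρ of its end iff all its edges
-- are (−)-primary, and dually for τ.  Consequently a (−)-search path is
-- ρ(src f) f for its certificate f, or ρ(sink) if it is trivial; its proper
-- prefixes consist of primary edges, so no search path extends another, and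
-- each node v lies on the search path of the suffix spelled by ρ(v) τ(v).
-- A nonempty prefix of a search path ending in the edge g is ρ(tgt g) if g is
-- primary and ρ(src g) g otherwise, so the trie edges inject into the edges
-- of G.  The (+)-side is the mirror image.

module Submission where

open import Defs
open import Data.Empty using (⊥-elim)
open import Data.Fin using (Fin; zero; suc; toℕ; fromℕ<)
import Data.Fin as Fin
open import Data.Fin.Properties using (pigeonhole; toℕ<n; toℕ-fromℕ<)
open import Data.List
  using (List; []; _∷_; _++_; [_]; _∷ʳ_; length; drop; map; filter; concatMap; inits; tails; lookup; allFin;
         initLast; _∷ʳ′_)
open import Data.List.Properties
  using (++-conicalʳ; length-++; length-drop; concatMap-++; ++-cancelˡ; ++-cancelʳ; ∷-injective; ∷-injectiveˡ;
         ∷-injectiveʳ; ∷ʳ-injective; ∷ʳ-injectiveʳ; ++-assoc; ++-identityʳ)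
open import Data.List.Membership.Propositional using (_∈_)
open import Data.List.Membership.Propositional.Properties
  using (∈-map⁺; ∈-concatMap⁺; ∈-filter⁺; ∈-filter⁻; ∈-allFin; ∈-lookup; ∈-∃++)
open import Data.List.Relation.Unary.Any using (here; there)
import Data.List.Relation.Unary.Any as Any
open import Data.List.Relation.Unary.All using (All; []; _∷_)
import Data.List.Relation.Unary.All as All
import Data.List.Relation.Unary.All.Properties as All
open import Data.List.Relation.Unary.AllPairs using ([]; _∷_)
open import Data.List.Relation.Unary.Unique.Propositional using (Unique)
open import Data.List.Relation.Binary.Lex.Core using (this; next)
import Data.List.Relation.Binary.Lex.Strict as Lex
open import Data.List.Relation.Binary.Pointwise using (Pointwise-≡⇒≡)
open import Data.Nat using (ℕ; suc; _≤_; _<_; _+_; s≤s)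
open import Data.Nat.Properties
  using (≤-total; ≤-trans; ≤-antisym; ≤-reflexive; _≤?_; ≰⇒>; m≤m+n; +-cancelˡ-≤; +-cancelʳ-≤; ∸-cancelˡ-≡;
         <⇒≤; <-irrefl; <-isStrictTotalOrder)
open import Data.Product using (∃; ∃-syntax; _×_; _,_; proj₁; proj₂)
open import Data.Sum using (_⊎_; inj₁; inj₂; reduce)
open import Data.Unit using (tt)
open import Function using (_∘_; case_of_)
open import Level using (0ℓ)
open import Relation.Binary using (Rel; Total; Transitive; IsTotalOrder)
open import Relation.Binary.PropositionalEquality
  using (module ≡-Reasoning; _≡_; _≢_; refl; sym; trans; cong; subst; subst₂)
open import Relation.Nullary using (¬_; Dec; yes; no)
open import Relation.Unary using (Pred; Decidable)

private variable A : Set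

∈-inits-++ : (xs ys : List A) → xs ∈ inits (xs ++ ys)
∈-inits-++ []       ys = here refl
∈-inits-++ (x ∷ xs) ys = there (∈-map⁺ (x ∷_) (∈-inits-++ xs ys))

∈-tails-++ : (xs ys : List A) → ys ∈ tails (xs ++ ys)
∈-tails-++ []       []      = here refl
∈-tails-++ []       (_ ∷ _) = here refl
∈-tails-++ (x ∷ xs) ys      = there (∈-tails-++ xs ys)

∷ʳ≢[] : ∀ (xs : List A) {x} → xs ∷ʳ x ≢ []
∷ʳ≢[] xs xs∷ʳx≡[] with ++-conicalʳ xs _ xs∷ʳx≡[]
... | ()

proper-prefix-of-∷ʳ : ∀ (ρ α : List A) {x r f} → ρ ++ x ∷ r ≡ α ∷ʳ f → ∃[ r' ] ρ ++ r' ≡ α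
proper-prefix-of-∷ʳ []      α       _  = α , refl
proper-prefix-of-∷ʳ (_ ∷ ρ) []      eq with ++-conicalʳ ρ _ (∷-injectiveʳ eq)
... | ()
proper-prefix-of-∷ʳ (y ∷ ρ) (z ∷ α) eq with ∷-injective eq
... | refl , eq' with proper-prefix-of-∷ʳ ρ α eq'
...   | r' , refl = r' , refl

_EndsWith_ : List A → A → Set
xs EndsWith x = ∃[ ys ] xs ≡ ys ∷ʳ x

_StartsWith_ : List A → A → Set
xs StartsWith x = ∃[ ys ] xs ≡ x ∷ ys

nonempty-ends : ∀ (xs : List A) → xs ≢ [] → ∃ (xs EndsWith_)
nonempty-ends xs xs≢[] with initLast xs
... | []       = ⊥-elim (xs≢[] refl)
... | ys ∷ʳ′ y = y , ys , refl

nonempty-starts : ∀ (xs : List A) → xs ≢ [] → ∃ (xs StartsWith_)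
nonempty-starts []       xs≢[] = ⊥-elim (xs≢[] refl)
nonempty-starts (x ∷ xs) _     = x , xs , refl

module _ {P : Pred A 0ℓ} (P? : Decidable P) where

  All-or-first-failure : (xs : List A) →
    All P xs ⊎ ∃[ α ] ∃[ f ] ∃[ β ] xs ≡ α ++ f ∷ β × All P α × ¬ P f
  All-or-first-failure []       = inj₁ []
  All-or-first-failure (x ∷ xs) with P? x | All-or-first-failure xs
  ... | no ¬px | _                                  = inj₂ ([] , x , xs , refl , [] , ¬px)
  ... | yes px | inj₁ all                           = inj₁ (px ∷ all)
  ... | yes px | inj₂ (α , f , β , refl , pα , ¬pf) = inj₂ (x ∷ α , f , β , refl , px ∷ pα , ¬pf)

  All-or-last-failure : (xs : List A) →
    All P xs ⊎ ∃[ α ] ∃[ f ] ∃[ β ] xs ≡ α ++ f ∷ β × ¬ P f × All P β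
  All-or-last-failure []       = inj₁ []
  All-or-last-failure (x ∷ xs) with All-or-last-failure xs | P? x
  ... | inj₂ (α , f , β , refl , ¬pf , pβ) | _      = inj₂ (x ∷ α , f , β , refl , ¬pf , pβ)
  ... | inj₁ all                           | yes px = inj₁ (px ∷ all)
  ... | inj₁ all                           | no ¬px = inj₂ ([] , x , xs , refl , ¬px , all)

module _ {R : Rel A 0ℓ} (R-total : Total R) (R-trans : Transitive R) where

  least : ∀ {x} xs → x ∈ xs → ∃[ m ] m ∈ xs × All (R m) xs
  least (x ∷ [])     _ = x , here refl , reduce (R-total x x) ∷ []
  least (x ∷ y ∷ ys) _ with least (y ∷ ys) (here refl)
  ... | m , m∈ , m≤ with R-total x m
  ...   | inj₁ x≤m = x , here refl , reduce (R-total x x) ∷ All.map (R-trans x≤m) m≤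
  ...   | inj₂ m≤x = m , there m∈ , m≤x ∷ m≤

  least-satisfying : {P : Pred A 0ℓ} → Decidable P → (xs : List A) → (∀ {y} → P y → y ∈ xs) →
                     ∀ {x} → P x → ∃[ m ] P m × (∀ y → P y → R m y)
  least-satisfying P? xs complete px with least (filter P? xs) (∈-filter⁺ P? (complete px) px)
  ... | m , m∈ , m≤ =
    m , proj₂ (∈-filter⁻ P? {xs = xs} m∈) , λ _ py → All.lookup m≤ (∈-filter⁺ P? (complete py) py)

Unique⇒length≤ : ∀ {m} (ks : List (Fin m)) → Unique ks → length ks ≤ m
Unique⇒length≤ {m} ks unique with length ks ≤? m
... | yes ≤m = ≤m
... | no ≰m with pigeonhole (≰⇒> ≰m) (lookup ks)
...   | i , j , i<j , ki≡kj = ⊥-elim (distinct ks unique i j i<j ki≡kj)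
  where
  distinct : (ks : List (Fin _)) → Unique ks → ∀ i j → i Fin.< j → lookup ks i ≢ lookup ks j
  distinct (_ ∷ ks) (k∉ ∷ _) zero    (suc j) _         = All.lookup k∉ (∈-lookup j)
  distinct (_ ∷ ks) (_ ∷ u)  (suc i) (suc j) (s≤s i<j) = distinct ks u i j i<j

module _ {m} {P : Pred A 0ℓ} (K : A → Fin m → Set)
         (key : ∀ {x} → P x → ∃ (K x))
         (K-injective : ∀ {x y k} → P x → P y → K x k → K y k → x ≡ y) where

  private
    keys : ∀ {xs} → All P xs → List (Fin m)
    keys = All.reduce (proj₁ ∘ key)

    length-keys : ∀ {xs} (ps : All P xs) → length (keys ps) ≡ length xs
    length-keys []       = refl
    length-keys (_ ∷ ps) = cong suc (length-keys ps)

    Unique-keys : ∀ {xs} → Unique xs → (ps : All P xs) → Unique (keys ps)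
    Unique-keys []        []        = []
    Unique-keys (x∉ ∷ xs) (px ∷ ps) = distinct x∉ ps ∷ Unique-keys xs ps
      where
      distinct : ∀ {ys} → All (_ ≢_) ys → (qs : All P ys) → All (proj₁ (key px) ≢_) (keys qs)
      distinct []          []        = []
      distinct (x≢y ∷ x≢s) (py ∷ qs) =
        (λ k≡ → x≢y (K-injective px py (proj₂ (key px)) (subst (K _) (sym k≡) (proj₂ (key py)))))
        ∷ distinct x≢s qs

  Unique-All⇒length≤ : ∀ xs → Unique xs → All P xs → length xs ≤ m
  Unique-All⇒length≤ xs unique ps =
    subst (_≤ m) (length-keys ps) (Unique⇒length≤ (keys ps) (Unique-keys unique ps))

≤pos-total : Total _≤pos_
≤pos-total s t = ≤-total (length t) (length s)

≤pos-trans : Transitive _≤pos_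
≤pos-trans {s} {t} {u} s≤t t≤u = ≤-trans {length u} {length t} {length s} t≤u s≤t

≤pos-cancelˡ : ∀ u {s t} → (u ++ s) ≤pos (u ++ t) → s ≤pos t
≤pos-cancelˡ u {s} {t} =
  +-cancelˡ-≤ (length u) (length t) (length s) ∘ subst₂ _≤_ (length-++ u) (length-++ u)

≤pos-cancelʳ : ∀ u {s t} → (s ++ u) ≤pos (t ++ u) → s ≤pos t
≤pos-cancelʳ u {s} {t} =
  +-cancelʳ-≤ (length u) (length t) (length s) ∘ subst₂ _≤_ (length-++ t) (length-++ s)

private module ≤lex = IsTotalOrder (Lex.≤-isTotalOrder {_≈_ = _≡_} {_≺_ = _<_} <-isStrictTotalOrder)

≤lex-cancelˡ : ∀ u {s t} → (u ++ s) ≤lex (u ++ t) → s ≤lex t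
≤lex-cancelˡ []      s≤t               = s≤t
≤lex-cancelˡ (x ∷ u) (this x<x)        = ⊥-elim (<-irrefl refl x<x)
≤lex-cancelˡ (x ∷ u) (next refl us≤ut) = ≤lex-cancelˡ u us≤ut

⪯₊-total : ∀ o → Total ⟦ o ⟧₊
⪯₊-total lexOrder = ≤lex.total
⪯₊-total posOrder = ≤pos-total

⪯₊-trans : ∀ o → Transitive ⟦ o ⟧₊
⪯₊-trans lexOrder               = ≤lex.trans
⪯₊-trans posOrder {s} {t} {u} = ≤pos-trans {s} {t} {u}

⪯₊-refl : ∀ o s → ⟦ o ⟧₊ s s
⪯₊-refl o s = reduce (⪯₊-total o s s)

⪯₊-antisym-length : ∀ o {s t} → ⟦ o ⟧₊ s t → ⟦ o ⟧₊ t s → length s ≡ length t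
⪯₊-antisym-length lexOrder s≤t t≤s = cong length (Pointwise-≡⇒≡ (≤lex.antisym s≤t t≤s))
⪯₊-antisym-length posOrder s≤t t≤s = ≤-antisym t≤s s≤t

⪯₊-cancelˡ : ∀ o u {s t} → ⟦ o ⟧₊ (u ++ s) (u ++ t) → ⟦ o ⟧₊ s t
⪯₊-cancelˡ lexOrder = ≤lex-cancelˡ
⪯₊-cancelˡ posOrder = ≤pos-cancelˡ

suffix-length-injective : ∀ {S S' T} → IsSuffixOf S T → IsSuffixOf S' T → length S ≡ length S' → S ≡ S'
suffix-length-injective {T = T} (q , q< , refl) (q' , q'< , refl) |S|≡|S'| =
  cong (λ k → drop k T) (∸-cancelˡ-≡ (<⇒≤ q<) (<⇒≤ q'<)
    (trans (sym (length-drop q T)) (trans |S|≡|S'| (length-drop q' T))))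

-- Paths in edge-labelled graphs

module _ {G : Graph} where
  open Graph G

  pattern step p = _∷_ p

  IsPath-++ : ∀ {u v w α β} → IsPath G u α v → IsPath G v β w → IsPath G u (α ++ β) w
  IsPath-++ []       q = q
  IsPath-++ (step p) q = step (IsPath-++ p q)

  IsPath-split : ∀ {u w β} α → IsPath G u (α ++ β) w → ∃[ v ] IsPath G u α v × IsPath G v β w
  IsPath-split []      p        = _ , [] , p
  IsPath-split (_ ∷ α) (step p) with IsPath-split α p
  ... | v , p₁ , p₂ = v , step p₁ , p₂

  IsPath-split-at-edge : ∀ {u w f β} α → IsPath G u (α ++ f ∷ β) w →
                         IsPath G u α (src f) × IsPath G (tgt f) β w
  IsPath-split-at-edge α p with IsPath-split α p
  ... | _ , pα , step pβ = pα , pβ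

  IsPath-to-tgt : ∀ {u v α g} → IsPath G u (α ∷ʳ g) v → IsPath G u (α ∷ʳ g) (tgt g)
  IsPath-to-tgt {α = α} p = IsPath-++ (proj₁ (IsPath-split-at-edge α p)) (step [])

  IsPath-from-src : ∀ {u v f π} → IsPath G u (f ∷ π) v → IsPath G (src f) (f ∷ π) v
  IsPath-from-src (step p) = step p

  IsPath-target-unique : ∀ {u π v v'} → IsPath G u π v → IsPath G u π v' → v ≡ v'
  IsPath-target-unique []       []       = refl
  IsPath-target-unique (step p) (step q) = IsPath-target-unique p q

  IsPath-source-unique : ∀ {u u' π v} → IsPath G u π v → IsPath G u' π v → u ≡ u'
  IsPath-source-unique []       []       = refl
  IsPath-source-unique (step _) (step _) = refl

module _ (G : Graph) where
  open Graph G

  IsPath? : ∀ u π v → Dec (IsPath G u π v)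
  IsPath? u [] v with u Fin.≟ v
  ... | yes refl = yes []
  ... | no u≢v   = no λ { [] → u≢v refl }
  IsPath? u (f ∷ π) v with u Fin.≟ src f | IsPath? (tgt f) π v
  ... | yes refl | yes p = yes (step p)
  ... | yes refl | no ¬p = no λ { (step p) → ¬p p }
  ... | no u≢src | _     = no λ { (step _) → u≢src refl }

  spell-++ : ∀ α β → spell G (α ++ β) ≡ spell G α ++ spell G β
  spell-++ = concatMap-++ label

  length-spell-++ : ∀ α β → length (spell G (α ++ β)) ≡ length (spell G α) + length (spell G β)
  length-spell-++ α β = trans (cong length (spell-++ α β)) (length-++ (spell G α))

-- Complete paths and representatives in a CDAWG

module CDAWG (T : Str) (G : Graph) (cdawg : IsCDAWGOf G T) where
  open Graph G
  open IsCDAWGOf cdawg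

  private
    Path = IsPath G
    Repr₋ = IsRepr₋Path G
    Primary₋ = EP₋ G

    ⟪_⟫ : EPath G → Str
    ⟪_⟫ = spell G

  no-cycle : ∀ {v π} → Path v π v → π ≡ []
  no-cycle {π = []}    _ = refl
  no-cycle {π = _ ∷ _} p = ⊥-elim (acyclic _ _ _ p)

  sink-has-no-out-path : ∀ {f π w} → ¬ Path sink (f ∷ π) w
  sink-has-no-out-path {f} {π} {w} p =
    acyclic sink f (π ++ proj₁ (toSink w)) (IsPath-++ p (proj₂ (toSink w)))

  root-has-no-in-path : ∀ {u f π} → ¬ Path u (f ∷ π) root
  root-has-no-in-path {u} {f} {π} p with no-cycle (IsPath-++ (proj₂ (fromRoot u)) p)
  ... | cycle≡[] with ++-conicalʳ (proj₁ (fromRoot u)) (f ∷ π) cycle≡[]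
  ... | ()

  complete-path-unique : ∀ {π π'} → Path root π sink → Path root π' sink →
                         length ⟪ π ⟫ ≡ length ⟪ π' ⟫ → π ≡ π'
  complete-path-unique p p' |π|≡|π'| =
    spellInj _ _ p p' (suffix-length-injective (spellSuffix _ p) (spellSuffix _ p') |π|≡|π'|)

  private
    completePathAt : Fin (length T) → EPath G
    completePathAt i = proj₁ (spellOnto (drop (toℕ i) T) (toℕ i , toℕ<n i , refl))

    completePathAt-spells : ∀ i → Path root (completePathAt i) sink × ⟪ completePathAt i ⟫ ≡ drop (toℕ i) T
    completePathAt-spells i = proj₂ (spellOnto (drop (toℕ i) T) (toℕ i , toℕ<n i , refl))

  completePaths : List (EPath G)
  completePaths = map completePathAt (allFin (length T))

  ∈-completePaths : ∀ {π} → Path root π sink → π ∈ completePaths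
  ∈-completePaths {π} p with spellSuffix π p
  ... | q , q< , ⟪π⟫≡ = subst (_∈ completePaths) (sym π≡) (∈-map⁺ completePathAt (∈-allFin i))
    where
    i = fromℕ< q<
    π≡ : π ≡ completePathAt i
    π≡ = spellInj _ _ p (proj₁ (completePathAt-spells i)) (begin
      ⟪ π ⟫                  ≡⟨ ⟪π⟫≡ ⟩
      drop q T               ≡⟨ cong (λ k → drop k T) (sym (toℕ-fromℕ< q<)) ⟩
      drop (toℕ i) T         ≡⟨ sym (proj₂ (completePathAt-spells i)) ⟩
      ⟪ completePathAt i ⟫   ∎)
      where open ≡-Reasoning

  ∈-prefixes-of-completePaths : ∀ {ρ v} → Path root ρ v → ρ ∈ concatMap inits completePaths
  ∈-prefixes-of-completePaths {ρ} {v} p with toSink v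
  ... | ξ , q =
    ∈-concatMap⁺ inits (Any.map (λ { refl → ∈-inits-++ ρ ξ }) (∈-completePaths (IsPath-++ p q)))

  ∈-suffixes-of-completePaths : ∀ {τ v} → Path v τ sink → τ ∈ concatMap tails completePaths
  ∈-suffixes-of-completePaths {τ} {v} p with fromRoot v
  ... | ρ , q =
    ∈-concatMap⁺ tails (Any.map (λ { refl → ∈-tails-++ ρ τ }) (∈-completePaths (IsPath-++ q p)))

  repr₋-root : Repr₋ root []
  repr₋-root = [] , λ π p → ≤-reflexive (cong (length ∘ ⟪_⟫) (no-cycle p))

  ∃-repr₋ : ∀ v → ∃[ ρ ] Repr₋ v ρ
  ∃-repr₋ v =
    least-satisfying (λ π π' → ≤pos-total ⟪ π ⟫ ⟪ π' ⟫)
                     (λ {π π' π''} → ≤pos-trans {⟪ π ⟫} {⟪ π' ⟫} {⟪ π'' ⟫})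
      (λ π → IsPath? G root π v) _ ∈-prefixes-of-completePaths (proj₂ (fromRoot v))

  repr₋-unique : ∀ {v ρ ρ'} → Repr₋ v ρ → Repr₋ v ρ' → ρ ≡ ρ'
  repr₋-unique {v} {ρ} {ρ'} (p , min) (p' , min') with toSink v
  ... | ξ , q = ++-cancelʳ ξ ρ ρ' (complete-path-unique (IsPath-++ p q) (IsPath-++ p' q) (begin
    length ⟪ ρ ++ ξ ⟫              ≡⟨ length-spell-++ G ρ ξ ⟩
    length ⟪ ρ ⟫ + length ⟪ ξ ⟫    ≡⟨ cong (_+ length ⟪ ξ ⟫) (≤-antisym (min' ρ p) (min ρ' p')) ⟩
    length ⟪ ρ' ⟫ + length ⟪ ξ ⟫   ≡⟨ sym (length-spell-++ G ρ' ξ) ⟩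
    length ⟪ ρ' ++ ξ ⟫             ∎))
    where open ≡-Reasoning

  repr₋-prefix : ∀ {u v} α β → Repr₋ v (α ++ β) → Path root α u → Repr₋ u α
  repr₋-prefix α β (p , min) pα with IsPath-split α p
  ... | _ , pα' , pβ with IsPath-target-unique pα' pα
  ...   | refl = pα , λ π pπ → ≤pos-cancelʳ ⟪ β ⟫ {⟪ α ⟫} {⟪ π ⟫}
                     (subst₂ _≤pos_ (spell-++ G α β) (spell-++ G π β) (min (π ++ β) (IsPath-++ pπ pβ)))

  repr₋-edge-primary : ∀ {v ρ g} → Repr₋ v ρ → g ∈ ρ → Primary₋ g
  repr₋-edge-primary {v} {g = g} r g∈ρ with ∈-∃++ g∈ρ
  ... | α , β , refl =
    α , repr₋-prefix (α ∷ʳ g) β (subst (Repr₋ v) (sym (++-assoc α [ g ] β)) r)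
                     (IsPath-++ (proj₁ (IsPath-split-at-edge α (proj₁ r))) (step []))

  repr₋⇒primary : ∀ {v ρ} → Repr₋ v ρ → All Primary₋ ρ
  repr₋⇒primary r = All.tabulate (repr₋-edge-primary r)

  extend-repr₋ : ∀ {u v α β} → Repr₋ u α → Path u β v → All Primary₋ β → Repr₋ v (α ++ β)
  extend-repr₋ {α = α} r [] [] = subst (Repr₋ _) (sym (++-identityʳ α)) r
  extend-repr₋ {α = α} {g ∷ β} r (step p) ((π , rπg) ∷ prim) with IsPath-split π (proj₁ rπg)
  ... | _ , pπ , step [] with repr₋-unique r (repr₋-prefix π [ g ] rπg pπ)
  ...   | refl = subst (Repr₋ _) (++-assoc α [ g ] β) (extend-repr₋ rπg p prim)

  primary⇒repr₋ : ∀ {v ρ} → Path root ρ v → All Primary₋ ρ → Repr₋ v ρ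
  primary⇒repr₋ = extend-repr₋ repr₋-root

  primary₋-path-unique : ∀ {v ρ ρ'} → Path root ρ v → All Primary₋ ρ → Path root ρ' v → All Primary₋ ρ' →
                         ρ ≡ ρ'
  primary₋-path-unique p prim p' prim' = repr₋-unique (primary⇒repr₋ p prim) (primary⇒repr₋ p' prim')

  Primary₋? : Decidable Primary₋
  Primary₋? f with ∃-repr₋ (tgt f)
  ... | ρ , r with initLast ρ
  ...   | []      = no λ (π , r') → ∷ʳ≢[] π (sym (repr₋-unique r r'))
  ...   | α ∷ʳ′ g with f Fin.≟ g
  ...     | yes refl = yes (α , r)
  ...     | no f≢g   = no λ (π , r') → f≢g (sym (∷ʳ-injectiveʳ α π (repr₋-unique r r')))

  module PlusRepresentatives (o : PlusOrder) where
    private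
      Repr₊ = IsRepr₊Path G o
      Primary₊ = EP₊ G o

    repr₊-sink : Repr₊ sink []
    repr₊-sink = [] , λ π p → subst (λ π → ⟦ o ⟧₊ [] ⟪ π ⟫) (sym (no-cycle p)) (⪯₊-refl o [])

    ∃-repr₊ : ∀ v → ∃[ τ ] Repr₊ v τ
    ∃-repr₊ v = least-satisfying (λ π π' → ⪯₊-total o ⟪ π ⟫ ⟪ π' ⟫) (⪯₊-trans o)
                  (λ π → IsPath? G v π sink) _ ∈-suffixes-of-completePaths (proj₂ (toSink v))

    repr₊-unique : ∀ {v τ τ'} → Repr₊ v τ → Repr₊ v τ' → τ ≡ τ'
    repr₊-unique {v} {τ} {τ'} (p , min) (p' , min') with fromRoot v
    ... | ρ , q = ++-cancelˡ ρ τ τ' (complete-path-unique (IsPath-++ q p) (IsPath-++ q p') (begin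
      length ⟪ ρ ++ τ ⟫              ≡⟨ length-spell-++ G ρ τ ⟩
      length ⟪ ρ ⟫ + length ⟪ τ ⟫    ≡⟨ cong (length ⟪ ρ ⟫ +_) (⪯₊-antisym-length o (min τ' p') (min' τ p)) ⟩
      length ⟪ ρ ⟫ + length ⟪ τ' ⟫   ≡⟨ sym (length-spell-++ G ρ τ') ⟩
      length ⟪ ρ ++ τ' ⟫             ∎))
      where open ≡-Reasoning

    repr₊-suffix : ∀ {u v} α β → Repr₊ v (α ++ β) → Path u β sink → Repr₊ u β
    repr₊-suffix α β (p , min) pβ with IsPath-split α p
    ... | _ , pα , pβ' with IsPath-source-unique pβ' pβ
    ...   | refl = pβ , λ π pπ → ⪯₊-cancelˡ o ⟪ α ⟫
                       (subst₂ ⟦ o ⟧₊ (spell-++ G α β) (spell-++ G α π) (min (α ++ π) (IsPath-++ pα pπ)))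

    repr₊-edge-primary : ∀ {v τ g} → Repr₊ v τ → g ∈ τ → Primary₊ g
    repr₊-edge-primary r g∈τ with ∈-∃++ g∈τ
    ... | α , β , refl = β , repr₊-suffix α (_ ∷ β) r (step (proj₂ (IsPath-split-at-edge α (proj₁ r))))

    repr₊⇒primary : ∀ {v τ} → Repr₊ v τ → All Primary₊ τ
    repr₊⇒primary r = All.tabulate (repr₊-edge-primary r)

    primary⇒repr₊ : ∀ {v τ} → Path v τ sink → All Primary₊ τ → Repr₊ v τ
    primary⇒repr₊ []       []                 = repr₊-sink
    primary⇒repr₊ (step p) ((π , rgπ) ∷ prim) with proj₁ rgπ
    ... | step pπ with repr₊-unique (primary⇒repr₊ p prim) (repr₊-suffix [ _ ] π rgπ pπ)
    ...   | refl = rgπ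

    primary₊-path-unique : ∀ {v τ τ'} → Path v τ sink → All Primary₊ τ → Path v τ' sink → All Primary₊ τ' →
                           τ ≡ τ'
    primary₊-path-unique p prim p' prim' = repr₊-unique (primary⇒repr₊ p prim) (primary⇒repr₊ p' prim')

    Primary₊? : Decidable Primary₊
    Primary₊? f with ∃-repr₊ (src f)
    ... | [] , r    = no λ (π , r') → case repr₊-unique r r' of λ ()
    ... | g ∷ τ , r with f Fin.≟ g
    ...   | yes refl = yes (τ , r)
    ...   | no f≢g   = no λ (π , r') → f≢g (sym (∷-injectiveˡ (repr₊-unique r r')))

  -- Search paths

  module SearchTrees (o : PlusOrder) where
    open PlusRepresentatives o

    private
      Primary₊ = EP₊ G o
      Search₋ = SearchPath₋ G T o
      Search₊ = SearchPath₊ G T o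

    -- σ is a parameter, not an index, so that two views of the same σ can be
    -- matched at once without unifying α ∷ʳ f with α' ∷ʳ f'.
    data Search₋View (σ : EPath G) : Cert G → Set where
      canonical : ∀ {α f} → σ ≡ α ∷ʳ f → Path root α (src f) → All Primary₋ α → ES₋ G f →
                  Search₋View σ (inj₁ f)
      trivial   : Path root σ sink → All Primary₋ σ → Search₋View σ (inj₂ tt)

    data Search₊View (σ : EPath G) : Cert G → Set where
      canonical : ∀ {f β} → σ ≡ f ∷ β → Path (tgt f) β sink → ES₊ G o f → All Primary₊ β →
                  Search₊View σ (inj₁ f)
      trivial   : Path root σ sink → All Primary₊ σ → Search₊View σ (inj₂ tt)

    search₋-view : ∀ {σ c} → Search₋ σ c → Search₋View σ c
    search₋-view (canonical _ _ α _ _ _ p _ refl prim sec _) =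
      canonical refl (proj₁ (IsPath-split-at-edge α p)) prim sec
    search₋-view (trivial _ _ _ p _ prim) = trivial p prim

    search₊-view : ∀ {σ c} → Search₊ σ c → Search₊View σ c
    search₊-view (canonical _ _ α _ _ _ p _ refl _ sec prim) =
      canonical refl (proj₂ (IsPath-split-at-edge α p)) sec prim
    search₊-view (trivial _ _ _ p _ prim) = trivial p prim

    search₋-canonical : ∀ {α f β} → Path root α (src f) → All Primary₋ α → ES₋ G f →
                        Path (tgt f) β sink → All Primary₊ β → Search₋ (α ∷ʳ f) (inj₁ f)
    search₋-canonical {α} {f} {β} pα prim₋ sec pβ prim₊ =
      canonical _ (α ++ f ∷ β) α f β (spellSuffix _ p) p refl refl prim₋ sec prim₊
      where p = IsPath-++ pα (step pβ)

    search₊-canonical : ∀ {α f β} → Path root α (src f) → All Primary₋ α → ES₊ G o f →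
                        Path (tgt f) β sink → All Primary₊ β → Search₊ (f ∷ β) (inj₁ f)
    search₊-canonical {α} {f} {β} pα prim₋ sec pβ prim₊ =
      canonical _ (α ++ f ∷ β) α f β (spellSuffix _ p) p refl refl prim₋ sec prim₊
      where p = IsPath-++ pα (step pβ)

    search₋-trivial : ∀ {σ} → Path root σ sink → All Primary₋ σ → Search₋ σ (inj₂ tt)
    search₋-trivial p prim = trivial _ _ (spellSuffix _ p) p refl prim

    search₊-trivial : ∀ {σ} → Path root σ sink → All Primary₊ σ → Search₊ σ (inj₂ tt)
    search₊-trivial p prim = trivial _ _ (spellSuffix _ p) p refl prim

    search₋-path : ∀ {σ c} → Search₋ σ c → ∃[ v ] Path root σ v
    search₋-path s with search₋-view s
    ... | canonical refl pα _ _ = _ , IsPath-++ pα (step [])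
    ... | trivial p _           = sink , p

    search₊-path : ∀ {σ c} → Search₊ σ c → ∃[ v ] Path v σ sink
    search₊-path s with search₊-view s
    ... | canonical refl pβ _ _ = _ , step pβ
    ... | trivial p _           = root , p

    search₋-proper-prefix-primary : ∀ {σ c ρ x r} → Search₋ σ c → ρ ++ x ∷ r ≡ σ → All Primary₋ ρ
    search₋-proper-prefix-primary {ρ = ρ} s eq with search₋-view s
    ... | canonical {α} refl _ prim _ with proper-prefix-of-∷ʳ ρ α eq
    ...   | _ , refl = All.++⁻ˡ ρ prim
    search₋-proper-prefix-primary {ρ = ρ} s refl | trivial _ prim = All.++⁻ˡ ρ prim

    search₊-proper-suffix-primary : ∀ {σ c x r τ} → Search₊ σ c → x ∷ r ++ τ ≡ σ → All Primary₊ τ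
    search₊-proper-suffix-primary {r = r} s eq with search₊-view s
    ... | canonical refl _ _ prim = All.++⁻ʳ r (subst (All Primary₊) (sym (∷-injectiveʳ eq)) prim)
    search₊-proper-suffix-primary {x = x} {r} s refl | trivial _ prim = All.++⁻ʳ (x ∷ r) prim

    search₋-prefix : ∀ {ρ σ c} → Search₋ σ c → IsPrefix G ρ σ →
                     Search₋ ρ c ⊎ (All Primary₋ ρ × ∃[ v ] Path root ρ v)
    search₋-prefix {ρ} {c = c} s ([] , eq) =
      inj₁ (subst (λ σ → Search₋ σ c) (sym (trans (sym (++-identityʳ ρ)) eq)) s)
    search₋-prefix {ρ} s (x ∷ r , eq) with search₋-path s
    ... | _ , pσ = inj₂ (search₋-proper-prefix-primary s eq ,
                         _ , proj₁ (proj₂ (IsPath-split ρ (subst (λ σ → Path root σ _) (sym eq) pσ))))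

    search₊-suffix : ∀ {τ σ c} → Search₊ σ c → IsSuffix G τ σ →
                     Search₊ τ c ⊎ (All Primary₊ τ × ∃[ v ] Path v τ sink)
    search₊-suffix s ([] , refl) = inj₁ s
    search₊-suffix s (x ∷ r , eq) with search₊-path s
    ... | _ , pσ = inj₂ (search₊-proper-suffix-primary s eq ,
                         _ , proj₂ (proj₂ (IsPath-split (x ∷ r) (subst (λ σ → Path _ σ sink) (sym eq) pσ))))

    search₋-leaves : ∀ σ σ' c c' → Search₋ σ c → Search₋ σ' c' → IsPrefix G σ σ' → σ ≡ σ'
    search₋-leaves σ σ' c c' s s' ([] , eq) = trans (sym (++-identityʳ σ)) eq
    search₋-leaves σ σ' c c' s s' (x ∷ r , eq) with search₋-view s | search₋-proper-prefix-primary s' eq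
    ... | canonical refl _ _ sec | prim = ⊥-elim (sec (proj₂ (All.∷ʳ⁻ prim)))
    ... | trivial p _            | _ with search₋-path s'
    ...   | _ , p' with IsPath-split σ (subst (λ σ' → Path root σ' _) (sym eq) p')
    ...     | _ , pσ , p-after with IsPath-target-unique pσ p
    ...       | refl = ⊥-elim (sink-has-no-out-path p-after)

    search₊-leaves : ∀ σ σ' c c' → Search₊ σ c → Search₊ σ' c' → IsSuffix G σ σ' → σ ≡ σ'
    search₊-leaves σ σ' c c' s s' ([] , eq) = eq
    search₊-leaves σ σ' c c' s s' (x ∷ r , eq) with search₊-view s | search₊-proper-suffix-primary {τ = σ} s' eq
    ... | canonical refl _ sec _ | prim ∷ _ = ⊥-elim (sec prim)
    ... | trivial p _            | _ with search₊-path s'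
    ...   | _ , p' with IsPath-split (x ∷ r) (subst (λ σ' → Path _ σ' sink) (sym eq) p')
    ...     | _ , p-before , pσ with IsPath-source-unique pσ p
    ...       | refl = ⊥-elim (root-has-no-in-path p-before)

    search₋-certificate-unique : ∀ σ c c' → Search₋ σ c → Search₋ σ c' → c ≡ c'
    search₋-certificate-unique σ c c' s s' with search₋-view s | search₋-view s'
    ... | canonical {α} e _ _ _  | canonical {α'} e' _ _ _ = cong inj₁ (∷ʳ-injectiveʳ α α' (trans (sym e) e'))
    ... | canonical refl _ _ sec | trivial _ prim          = ⊥-elim (sec (proj₂ (All.∷ʳ⁻ prim)))
    ... | trivial _ prim         | canonical refl _ _ sec  = ⊥-elim (sec (proj₂ (All.∷ʳ⁻ prim)))
    ... | trivial _ _            | trivial _ _             = refl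

    search₊-certificate-unique : ∀ σ c c' → Search₊ σ c → Search₊ σ c' → c ≡ c'
    search₊-certificate-unique σ c c' s s' with search₊-view s | search₊-view s'
    ... | canonical e _ _ _      | canonical e' _ _ _     = cong inj₁ (∷-injectiveˡ (trans (sym e) e'))
    ... | canonical refl _ sec _ | trivial _ (prim ∷ _)   = ⊥-elim (sec prim)
    ... | trivial _ (prim ∷ _)   | canonical refl _ sec _ = ⊥-elim (sec prim)
    ... | trivial _ _            | trivial _ _            = refl

    search₋-determined-by-certificate : ∀ σ σ' c → Search₋ σ c → Search₋ σ' c → σ ≡ σ'
    search₋-determined-by-certificate σ σ' c s s' with search₋-view s | search₋-view s'
    ... | canonical {f = f} refl p prim _ | canonical refl p' prim' _ =
      cong (_∷ʳ f) (primary₋-path-unique p prim p' prim')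
    ... | trivial p prim | trivial p' prim' = primary₋-path-unique p prim p' prim'

    search₊-determined-by-certificate : ∀ σ σ' c → Search₊ σ c → Search₊ σ' c → σ ≡ σ'
    search₊-determined-by-certificate σ σ' c s s' with search₊-view s | search₊-view s'
    ... | canonical {f} refl p _ prim | canonical refl p' _ prim' =
      cong (f ∷_) (primary₊-path-unique p prim p' prim')
    ... | trivial p prim | trivial p' prim' = primary₊-path-unique p prim p' prim'

    search₋-certificate-secondary : ∀ σ f → Search₋ σ (inj₁ f) → ES₋ G f
    search₋-certificate-secondary σ f s with search₋-view s
    ... | canonical _ _ _ sec = sec

    search₊-certificate-secondary : ∀ σ f → Search₊ σ (inj₁ f) → ES₊ G o f
    search₊-certificate-secondary σ f s with search₊-view s
    ... | canonical _ _ sec _ = sec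

    search₋-of-secondary : ∀ f → ES₋ G f → ∃[ σ ] Search₋ σ (inj₁ f)
    search₋-of-secondary f sec with ∃-repr₋ (src f) | ∃-repr₊ (tgt f)
    ... | ρ , rρ | τ , rτ =
      ρ ∷ʳ f , search₋-canonical (proj₁ rρ) (repr₋⇒primary rρ) sec (proj₁ rτ) (repr₊⇒primary rτ)

    search₊-of-secondary : ∀ f → ES₊ G o f → ∃[ σ ] Search₊ σ (inj₁ f)
    search₊-of-secondary f sec with ∃-repr₋ (src f) | ∃-repr₊ (tgt f)
    ... | ρ , rρ | τ , rτ =
      f ∷ τ , search₊-canonical (proj₁ rρ) (repr₋⇒primary rρ) sec (proj₁ rτ) (repr₊⇒primary rτ)

    search₋-trivial-exists : ∃[ σ ] Search₋ σ (inj₂ tt)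
    search₋-trivial-exists with ∃-repr₋ sink
    ... | ρ , rρ = ρ , search₋-trivial (proj₁ rρ) (repr₋⇒primary rρ)

    search₊-trivial-exists : ∃[ σ ] Search₊ σ (inj₂ tt)
    search₊-trivial-exists with ∃-repr₊ root
    ... | τ , rτ = τ , search₊-trivial (proj₁ rτ) (repr₊⇒primary rτ)

    search₋-through : ∀ {ρ v τ} → Path root ρ v → All Primary₋ ρ → Path v τ sink → All Primary₊ τ →
                      ∃[ σ ] ∃[ c ] Search₋ σ c × IsPrefix G ρ σ
    search₋-through {ρ} {τ = τ} pρ primρ pτ primτ with All-or-first-failure Primary₋? τ
    ... | inj₁ primτ₋ =
      ρ ++ τ , inj₂ tt , search₋-trivial (IsPath-++ pρ pτ) (All.++⁺ primρ primτ₋) , τ , refl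
    ... | inj₂ (α , f , β , refl , primα , sec) =
      (ρ ++ α) ∷ʳ f , inj₁ f ,
      search₋-canonical (IsPath-++ pρ pα) (All.++⁺ primρ primα) sec pβ (All.tail (All.++⁻ʳ α primτ)) ,
      α ∷ʳ f , sym (++-assoc ρ α [ f ])
      where
      pα = proj₁ (IsPath-split-at-edge α pτ)
      pβ = proj₂ (IsPath-split-at-edge α pτ)

    search₊-through : ∀ {ρ v τ} → Path root ρ v → All Primary₋ ρ → Path v τ sink → All Primary₊ τ →
                      ∃[ σ ] ∃[ c ] Search₊ σ c × IsSuffix G τ σ
    search₊-through {ρ} {τ = τ} pρ primρ pτ primτ with All-or-last-failure Primary₊? ρ
    ... | inj₁ primρ₊ =
      ρ ++ τ , inj₂ tt , search₊-trivial (IsPath-++ pρ pτ) (All.++⁺ primρ₊ primτ) , ρ , refl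
    ... | inj₂ (α , f , β , refl , sec , primβ) =
      f ∷ β ++ τ , inj₁ f ,
      search₊-canonical pα (All.++⁻ˡ α primρ) sec (IsPath-++ pβ pτ) (All.++⁺ primβ primτ) ,
      f ∷ β , refl
      where
      pα = proj₁ (IsPath-split-at-edge α pρ)
      pβ = proj₂ (IsPath-split-at-edge α pρ)

    search₋-spans : ∀ v → ∃[ σ ] ∃[ c ] ∃[ ρ ] Search₋ σ c × IsPrefix G ρ σ × Path root ρ v
    search₋-spans v with ∃-repr₋ v | ∃-repr₊ v
    ... | ρ , rρ | τ , rτ with search₋-through (proj₁ rρ) (repr₋⇒primary rρ) (proj₁ rτ) (repr₊⇒primary rτ)
    ...   | σ , c , s , ρ≼σ = σ , c , ρ , s , ρ≼σ , proj₁ rρ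

    search₊-spans : ∀ v → ∃[ σ ] ∃[ c ] ∃[ τ ] Search₊ σ c × IsSuffix G τ σ × Path v τ sink
    search₊-spans v with ∃-repr₋ v | ∃-repr₊ v
    ... | ρ , rρ | τ , rτ with search₊-through (proj₁ rρ) (repr₋⇒primary rρ) (proj₁ rτ) (repr₊⇒primary rτ)
    ...   | σ , c , s , τ≼σ = σ , c , τ , s , τ≼σ , proj₁ rτ

    -- The two tries

    private
      Edge₋ = PrefixTrieEdge G (λ σ → ∃[ c ] Search₋ σ c)
      Edge₊ = SuffixTrieEdge G (λ σ → ∃[ c ] Search₊ σ c)

    prefix-trie-edge-cases : ∀ {α g} → Edge₋ (α ∷ʳ g) →
                             Search₋ (α ∷ʳ g) (inj₁ g) ⊎ (All Primary₋ (α ∷ʳ g) × Path root (α ∷ʳ g) (tgt g))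
    prefix-trie-edge-cases {α} (_ , _ , (_ , s) , α∷ʳg≼σ) with search₋-prefix s α∷ʳg≼σ
    ... | inj₂ (prim , _ , p) = inj₂ (prim , IsPath-to-tgt p)
    ... | inj₁ s' with search₋-view s'
    ...   | trivial p prim = inj₂ (prim , IsPath-to-tgt p)
    ...   | canonical {α'} e _ _ _ with ∷ʳ-injective α α' e
    ...     | refl , refl = inj₁ s'

    suffix-trie-edge-cases : ∀ {g β} → Edge₊ (g ∷ β) →
                             Search₊ (g ∷ β) (inj₁ g) ⊎ (All Primary₊ (g ∷ β) × Path (src g) (g ∷ β) sink)
    suffix-trie-edge-cases (_ , _ , (_ , s) , g∷β≼σ) with search₊-suffix s g∷β≼σ
    ... | inj₂ (prim , _ , p) = inj₂ (prim , IsPath-from-src p)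
    ... | inj₁ s' with search₊-view s'
    ...   | trivial p prim       = inj₂ (prim , IsPath-from-src p)
    ...   | canonical refl _ _ _ = inj₁ s'

    prefix-trie-edge-injective : ∀ {p q g} → Edge₋ p → Edge₋ q → p EndsWith g → q EndsWith g → p ≡ q
    prefix-trie-edge-injective e e' (_ , refl) (_ , refl) with prefix-trie-edge-cases e | prefix-trie-edge-cases e'
    ... | inj₁ s          | inj₁ s'           = search₋-determined-by-certificate _ _ _ s s'
    ... | inj₂ (prim , p) | inj₂ (prim' , p') = primary₋-path-unique p prim p' prim'
    ... | inj₁ s          | inj₂ (prim' , _)  =
      ⊥-elim (search₋-certificate-secondary _ _ s (proj₂ (All.∷ʳ⁻ prim')))
    ... | inj₂ (prim , _) | inj₁ s'           =
      ⊥-elim (search₋-certificate-secondary _ _ s' (proj₂ (All.∷ʳ⁻ prim)))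

    suffix-trie-edge-injective : ∀ {p q g} → Edge₊ p → Edge₊ q → p StartsWith g → q StartsWith g → p ≡ q
    suffix-trie-edge-injective e e' (_ , refl) (_ , refl) with suffix-trie-edge-cases e | suffix-trie-edge-cases e'
    ... | inj₁ s            | inj₁ s'            = search₊-determined-by-certificate _ _ _ s s'
    ... | inj₂ (prim , p)   | inj₂ (prim' , p')  = primary₊-path-unique p prim p' prim'
    ... | inj₁ s            | inj₂ (pg ∷ _ , _)  = ⊥-elim (search₊-certificate-secondary _ _ s pg)
    ... | inj₂ (pg ∷ _ , _) | inj₁ s'            = ⊥-elim (search₊-certificate-secondary _ _ s' pg)

    prefix-trie-size : AtMostEdges G Edge₋ (size G)
    prefix-trie-size L unique trie-edges = ≤-trans
      (Unique-All⇒length≤ _EndsWith_ (nonempty-ends _ ∘ proj₁) prefix-trie-edge-injective L unique trie-edges)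
      (m≤m+n edges suffixLinks)

    suffix-trie-size : AtMostEdges G Edge₊ (size G)
    suffix-trie-size L unique trie-edges = ≤-trans
      (Unique-All⇒length≤ _StartsWith_ (nonempty-starts _ ∘ proj₁) suffix-trie-edge-injective L unique trie-edges)
      (m≤m+n edges suffixLinks)

proposition1 : (T : List ℕ) → EndMarked T → (G : Graph) → IsCDAWGOf G T → (o : PlusOrder) →
    ForwardSpanningTree G (SearchPath₋ G T o) (ES₋ G)
    × AtMostEdges G (PrefixTrieEdge G (λ σ → ∃[ c ] SearchPath₋ G T o σ c)) (size G)
    × BackwardSpanningTree G (SearchPath₊ G T o) (ES₊ G o)
    × AtMostEdges G (SuffixTrieEdge G (λ σ → ∃[ c ] SearchPath₊ G T o σ c)) (size G)
proposition1 T _ G cdawg o =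
    ( (λ _ _ → search₋-path) , search₋-leaves , search₋-spans
    , search₋-certificate-unique , search₋-determined-by-certificate
    , search₋-certificate-secondary , search₋-of-secondary , search₋-trivial-exists )
  , prefix-trie-size
  , ( (λ _ _ → search₊-path) , search₊-leaves , search₊-spans
    , search₊-certificate-unique , search₊-determined-by-certificate
    , search₊-certificate-secondary , search₊-of-secondary , search₊-trivial-exists )
  , suffix-trie-size
  where
  open CDAWG T G cdawg
  open SearchTrees o
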